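{- Let $s$ be an even positive integer and let $n=2s+2$. If $\mathcal{S}$ is a $2$-stable subset of $[n]$ of cardinality $\frac{s}{2}+1$, then there are $a,a'\in\mathcal{S}$ such that $a-a'\in\{s,s+1,s+2\}$.
   Context: $[n]=\{1,\dots,n\}$. For a positive integer $s$, a nonempty subset $\mathcal{S}\subseteq[n]$ is $s$-stable if for any two different elements $i,j\in\mathcal{S}$ we have $s\le |i-j|\le n-s$. -}

module Defs where

open import Data.Nat using (ℕ; _≤_; ∣_-_∣; _∸_)
open import Data.Product using (_×_)
open import Data.List using (List)
open import Data.List.Membership.Propositional using (_∈_)
open import Data.List.Relation.Unary.All using (All)
open import Data.List.Relation.Unary.Unique.Propositional using (Unique)
open import Relation.Binary.PropositionalEquality using (_≢_)

SubsetOf[_] : ℕ → List ℕ → Set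
SubsetOf[ n ] S = Unique S × All (λ i → 1 ≤ i × i ≤ n) S

-- s-stable (within [n]): any two different elements i, j satisfy
-- s ≤ |i - j| ≤ n - s.  (Nonemptiness is stated separately where needed.)
Stable : ℕ → ℕ → List ℕ → Set
Stable s n S = ∀ {i j} → i ∈ S → j ∈ S → i ≢ j → (s ≤ ∣ i - j ∣) × (∣ i - j ∣ ≤ n ∸ s)

-- Cut [2s+2] into the halves {1,…,s+1} and {s+2,…,2s+2} and send x to its
-- position in its half, an element of ℤ/(s+1).  If no two elements of S differ
-- by s, s+1 or s+2, two elements never share a position (they would differ by
-- s+1), and 2-stability rules out the remaining ways for two positions to be
-- cyclically consecutive.  So the positions of S form an independent set of the
-- cycle of length s+1, which has at most (s+1)/2 elements; but |S| = s/2 + 1.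
module Submission where

open import Defs
open import Data.Nat using (ℕ; _+_; _*_; _<_; _/_)
open import Data.Nat.Divisibility using (_∣_)
open import Data.Product using (∃₂; _×_)
open import Data.Sum using (_⊎_)
open import Data.List using (List; length)
open import Data.List.Membership.Propositional using (_∈_)
open import Relation.Binary.PropositionalEquality using (_≡_)

open import Data.Nat using (suc; zero; _≤_; _∸_; ∣_-_∣; s≤s; _≟_; _≤?_)
open import Data.Nat.Properties
open import Data.Nat.DivMod using (_%_; m%n<n; n%n≡0; m<n⇒m%n≡m; m*n/n≡m)
open import Data.Nat.Divisibility using (divides)
open import Data.Nat.Tactic.RingSolver using (solve-∀)
open import Data.Product using (_,_; proj₁; proj₂)
open import Data.Sum using (inj₁; inj₂)
open import Data.Empty using (⊥; ⊥-elim)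
open import Data.List using ([]; _∷_; map; _++_; upTo)
open import Data.List.Properties using (length-++; length-map; length-upTo)
open import Data.List.Relation.Unary.All as All using (All)
open import Data.List.Relation.Unary.Any using (here; there; any?)
open import Data.List.Relation.Unary.AllPairs using ([]; _∷_)
open import Data.List.Relation.Unary.Unique.Propositional using (Unique)
open import Data.List.Relation.Unary.Unique.Propositional.Properties using (++⁺; upTo⁺)
open import Data.List.Relation.Binary.Subset.Propositional using (_⊆_)
open import Data.List.Membership.Propositional using (find; lose)
open import Data.List.Membership.Propositional.Properties using (∈-map⁻; ∈-++⁻; ∈-upTo⁺)
open import Data.List.Fresh as Fresh using (fromList)
import Data.List.Fresh.Relation.Unary.Any as Any#
import Data.List.Fresh.Membership.Setoid as FreshMembership
import Data.List.Fresh.Membership.Setoid.Properties as FreshMembershipₚ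
open import Function using (id)
open import Relation.Nullary using (¬_; Dec; yes; no)
open import Relation.Nullary.Decidable using (_⊎-dec_)
open import Relation.Binary.PropositionalEquality
  using (_≢_; refl; sym; trans; cong; cong₂; subst; subst₂; setoid)

module _ {a} {A : Set a} where

  open FreshMembership (setoid A) using () renaming (_∈_ to _∈#_)

  private
    length-fromList : ∀ {xs : List A} (u : Unique xs) → Fresh.length (fromList u) ≡ length xs
    length-fromList []      = refl
    length-fromList (_ ∷ u) = cong suc (length-fromList u)

    ∈-fromList⁺ : ∀ {x} {xs : List A} (u : Unique xs) → x ∈ xs → x ∈# fromList u
    ∈-fromList⁺ (_ ∷ u) (here x≡y)   = Any#.here x≡y
    ∈-fromList⁺ (_ ∷ u) (there x∈xs) = Any#.there (∈-fromList⁺ u x∈xs)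

    ∈-fromList⁻ : ∀ {x} {xs : List A} (u : Unique xs) → x ∈# fromList u → x ∈ xs
    ∈-fromList⁻ (_ ∷ u) (Any#.here x≡y)   = here x≡y
    ∈-fromList⁻ (_ ∷ u) (Any#.there x∈xs) = there (∈-fromList⁻ u x∈xs)

  Unique-⊆⇒length≤ : ∀ {xs ys : List A} → Unique xs → Unique ys → xs ⊆ ys →
                     length xs ≤ length ys
  Unique-⊆⇒length≤ uxs uys xs⊆ys =
    subst₂ _≤_ (length-fromList uxs) (length-fromList uys)
      (FreshMembershipₚ.injection (setoid A) id
        (λ x∈xs → ∈-fromList⁺ uys (xs⊆ys (∈-fromList⁻ uxs x∈xs))))

  Unique-map⁺ : ∀ {b} {B : Set b} {f : A → B} {xs : List A} →
                (∀ {x y} → x ∈ xs → y ∈ xs → f x ≡ f y → x ≡ y) →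
                Unique xs → Unique (map f xs)
  Unique-map⁺ {xs = []}     f-inj []          = []
  Unique-map⁺ {xs = x ∷ xs} f-inj (x∉xs ∷ u) =
    All.tabulate (λ fy∈fxs fx≡fy →
      let y , y∈xs , fy≡ = ∈-map⁻ _ fy∈fxs
      in All.lookup x∉xs y∈xs (f-inj (here refl) (there y∈xs) (trans fx≡fy fy≡)))
    ∷ Unique-map⁺ (λ x∈xs y∈xs → f-inj (there x∈xs) (there y∈xs)) u

Unique-bounded⇒length≤ : ∀ k {xs : List ℕ} → Unique xs → All (_< k) xs → length xs ≤ k
Unique-bounded⇒length≤ k {xs} u xs<k =
  subst (length xs ≤_) (length-upTo k)
    (Unique-⊆⇒length≤ u (upTo⁺ k) (λ x∈xs → ∈-upTo⁺ (All.lookup xs<k x∈xs)))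

sucMod : ℕ → ℕ → ℕ
sucMod s v = suc v % suc s

sucMod-cases : ∀ {s v} → v ≤ s → (v ≡ s × sucMod s v ≡ 0) ⊎ sucMod s v ≡ suc v
sucMod-cases {s} {v} v≤s with v ≟ s
... | yes refl = inj₁ (refl , n%n≡0 (suc s))
... | no v≢s   = inj₂ (m<n⇒m%n≡m (s≤s (≤∧≢⇒< v≤s v≢s)))

sucMod-injective : ∀ {s u v} → u ≤ s → v ≤ s → sucMod s u ≡ sucMod s v → u ≡ v
sucMod-injective u≤s v≤s eq with sucMod-cases u≤s | sucMod-cases v≤s
... | inj₁ (u≡s , _)  | inj₁ (v≡s , _)  = trans u≡s (sym v≡s)
... | inj₂ u′≡        | inj₂ v′≡        = suc-injective (trans (sym u′≡) (trans eq v′≡))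
... | inj₁ (_ , u′≡0) | inj₂ v′≡        = ⊥-elim (0≢1+n (trans (sym u′≡0) (trans eq v′≡)))
... | inj₂ u′≡        | inj₁ (_ , v′≡0) = ⊥-elim (0≢1+n (trans (sym v′≡0) (trans (sym eq) u′≡)))

CycleIndependent : ℕ → List ℕ → Set
CycleIndependent s R = ∀ {u v} → u ∈ R → v ∈ R → u ≢ sucMod s v

-- R and its rotation by one are disjoint subsets of ℤ/(s+1) of the same size.
CycleIndependent⇒length≤ : ∀ s {R} → Unique R → All (_≤ s) R → CycleIndependent s R →
                           length R + length R ≤ suc s
CycleIndependent⇒length≤ s {R} uR R≤s indep =
  subst (_≤ suc s) length-R++R′
    (Unique-bounded⇒length≤ (suc s) (++⁺ uR uR′ disjoint) (All.tabulate bounded))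
  where
  R′ : List ℕ
  R′ = map (sucMod s) R

  uR′ : Unique R′
  uR′ = Unique-map⁺ (λ u∈R v∈R → sucMod-injective (All.lookup R≤s u∈R) (All.lookup R≤s v∈R)) uR

  disjoint : ∀ {w} → ¬ (w ∈ R × w ∈ R′)
  disjoint (w∈R , w∈R′) = let v , v∈R , w≡ = ∈-map⁻ (sucMod s) w∈R′ in indep w∈R v∈R w≡

  bounded : ∀ {w} → w ∈ R ++ R′ → w < suc s
  bounded w∈ with ∈-++⁻ R w∈
  ... | inj₁ w∈R  = s≤s (All.lookup R≤s w∈R)
  ... | inj₂ w∈R′ = let v , _ , w≡ = ∈-map⁻ (sucMod s) w∈R′
                    in subst (_< suc s) (sym w≡) (m%n<n (suc v) (suc s))

  length-R++R′ : length (R ++ R′) ≡ length R + length R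
  length-R++R′ = trans (length-++ R) (cong (length R +_) (length-map (sucMod s) R))

position : ℕ → ℕ → ℕ
position s x with x ≤? suc s
... | yes _ = x ∸ 1
... | no _  = x ∸ (2 + s)

data Half (s : ℕ) : ℕ → ℕ → Set where
  lower : ∀ {r} → r ≤ s → Half s (suc r) r
  upper : ∀ {r} → r ≤ s → Half s (suc r + suc s) r

Half⇒≤ : ∀ {s x r} → Half s x r → r ≤ s
Half⇒≤ (lower r≤s) = r≤s
Half⇒≤ (upper r≤s) = r≤s

half : ∀ s {x} → 1 ≤ x → x ≤ 2 * s + 2 → Half s x (position s x)
half s {suc x} _ x<n with suc x ≤? suc s
... | yes (s≤s x≤s) = lower x≤s
... | no x≰s = subst (λ y → Half s (suc y) (x ∸ suc s)) (m∸n+n≡m 1+s≤x) (upper r≤s)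
  where
  1+s≤x : suc s ≤ x
  1+s≤x = ≤-pred (≰⇒> x≰s)

  2s+2≡ : ∀ s → 2 * s + 2 ≡ suc (s + suc s)
  2s+2≡ = solve-∀

  r≤s : x ∸ suc s ≤ s
  r≤s = subst (x ∸ suc s ≤_) (m+n∸n≡m s (suc s))
          (∸-monoˡ-≤ (suc s) (≤-pred (subst (suc x ≤_) (2s+2≡ s) x<n)))

MiddleDifference : ℕ → ℕ → ℕ → Set
MiddleDifference s a a′ = a ≡ a′ + s ⊎ a ≡ a′ + (s + 1) ⊎ a ≡ a′ + (s + 2)

MiddleDifferenceFree : ℕ → List ℕ → Set
MiddleDifferenceFree s S = ∀ {a a′} → a ∈ S → a′ ∈ S → ¬ MiddleDifference s a a′

middleDifference-dec : ∀ s a a′ → Dec (MiddleDifference s a a′)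
middleDifference-dec s a a′ = (a ≟ a′ + s) ⊎-dec (a ≟ a′ + (s + 1)) ⊎-dec (a ≟ a′ + (s + 2))

middleDifference? : ∀ s S →
  (∃₂ λ a a′ → a ∈ S × a′ ∈ S × MiddleDifference s a a′) ⊎ MiddleDifferenceFree s S
middleDifference? s S with any? (λ a → any? (middleDifference-dec s a) S) S
... | yes found = let a , a∈S , found′ = find found ; a′ , a′∈S , d = find found′
                  in inj₁ (a , a′ , a∈S , a′∈S , d)
... | no none   = inj₂ (λ a∈S a′∈S d → none (lose a∈S (lose a′∈S d)))

∣n-1+n∣≡1 : ∀ n → ∣ n - suc n ∣ ≡ 1
∣n-1+n∣≡1 zero    = refl
∣n-1+n∣≡1 (suc n) = ∣n-1+n∣≡1 n

module MiddleDifferenceFreeStable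
  (s : ℕ) (S : List ℕ)
  (S⊆[n] : SubsetOf[ 2 * s + 2 ] S) (stable : Stable 2 (2 * s + 2) S)
  (free : MiddleDifferenceFree s S)
  where

  half∈ : ∀ {x} → x ∈ S → Half s x (position s x)
  half∈ x∈S = let 1≤x , x≤n = All.lookup (proj₂ S⊆[n]) x∈S in half s 1≤x x≤n

  not-adjacent : ∀ {x} → x ∈ S → suc x ∈ S → ⊥
  not-adjacent {x} x∈S 1+x∈S =
    let 2≤∣x-1+x∣ , _ = stable x∈S 1+x∈S (λ x≡1+x → 1+n≢n (sym x≡1+x))
    in 1+n≰n (subst (2 ≤_) (∣n-1+n∣≡1 x) 2≤∣x-1+x∣)

  -- 1 and 2s+2 are at distance 2s+1 > n - 2.
  not-both-ends : 1 ∈ S → suc s + suc s ∈ S → ⊥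
  not-both-ends 1∈S n∈S =
    let _ , ∣1-n∣≤n-2 = stable 1∈S n∈S (λ 1≡n → 0≢1+n (trans (suc-injective 1≡n) (+-suc s s)))
    in 1+n≰n (subst₂ _≤_ (+-suc s s) n-2≡ ∣1-n∣≤n-2)
    where
    n-2≡ : 2 * s + 2 ∸ 2 ≡ s + s
    n-2≡ = trans (m+n∸n≡m (2 * s) 2) (cong (s +_) (+-identityʳ s))

  position-injective : ∀ {x y} → x ∈ S → y ∈ S → position s x ≡ position s y → x ≡ y
  position-injective {y = y} x∈S y∈S eq =
    same-half x∈S y∈S (half∈ x∈S) (subst (Half s y) (sym eq) (half∈ y∈S))
    where
    gap : ∀ u → suc u + suc s ≡ suc u + (s + 1)
    gap u = cong (suc u +_) (+-comm 1 s)

    same-half : ∀ {x y u} → x ∈ S → y ∈ S → Half s x u → Half s y u → x ≡ y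
    same-half _   _   (lower _) (lower _) = refl
    same-half _   _   (upper _) (upper _) = refl
    same-half x∈S y∈S (lower _) (upper _) = ⊥-elim (free y∈S x∈S (inj₂ (inj₁ (gap _))))
    same-half x∈S y∈S (upper _) (lower _) = ⊥-elim (free x∈S y∈S (inj₂ (inj₁ (gap _))))

  positions-independent : CycleIndependent s (map (position s) S)
  positions-independent u∈ v∈ u≡ with ∈-map⁻ (position s) u∈ | ∈-map⁻ (position s) v∈
  ... | x , x∈S , refl | y , y∈S , refl =
    consecutive x∈S y∈S (half∈ x∈S) (half∈ y∈S) (cases (sucMod-cases (Half⇒≤ (half∈ y∈S))))
    where
    cases : (position s y ≡ s × sucMod s (position s y) ≡ 0) ⊎
              sucMod s (position s y) ≡ suc (position s y) →
            (position s y ≡ s × position s x ≡ 0) ⊎ position s x ≡ suc (position s y)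
    cases (inj₁ (v≡s , wrap)) = inj₁ (v≡s , trans u≡ wrap)
    cases (inj₂ next)         = inj₂ (trans u≡ next)

    consecutive : ∀ {x y u v} → x ∈ S → y ∈ S → Half s x u → Half s y v →
                  (v ≡ s × u ≡ 0) ⊎ u ≡ suc v → ⊥
    consecutive x∈S y∈S (lower _) (lower _) (inj₁ (refl , refl)) = free y∈S x∈S (inj₁ refl)
    consecutive x∈S y∈S (lower _) (upper _) (inj₁ (refl , refl)) = not-both-ends x∈S y∈S
    consecutive x∈S y∈S (upper _) (lower _) (inj₁ (refl , refl)) = not-adjacent y∈S x∈S
    consecutive x∈S y∈S (upper _) (upper _) (inj₁ (refl , refl)) =
      free y∈S x∈S (inj₁ (cong suc (+-suc s s)))
    consecutive x∈S y∈S (lower _) (lower _) (inj₂ refl) = not-adjacent y∈S x∈S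
    consecutive x∈S y∈S (upper _) (upper _) (inj₂ refl) = not-adjacent y∈S x∈S
    consecutive {v = v} x∈S y∈S (lower _) (upper _) (inj₂ refl) =
      free y∈S x∈S (inj₁ (cong suc (+-suc v s)))
    consecutive {v = v} x∈S y∈S (upper _) (lower _) (inj₂ refl) =
      free x∈S y∈S (inj₂ (inj₂ (cong suc (trans (sym (+-suc v (suc s))) (cong (v +_) (+-comm 2 s))))))

  length-bound : length S + length S ≤ suc s
  length-bound =
    subst (λ k → k + k ≤ suc s) (length-map (position s) S)
      (CycleIndependent⇒length≤ s
        (Unique-map⁺ position-injective (proj₁ S⊆[n]))
        (All.tabulate λ u∈ → let _ , x∈S , u≡ = ∈-map⁻ (position s) u∈
                             in subst (_≤ s) (sym u≡) (Half⇒≤ (half∈ x∈S)))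
        positions-independent)

lemma2 : (s : ℕ) → 0 < s → 2 ∣ s → (S : List ℕ) →
         SubsetOf[ 2 * s + 2 ] S → Stable 2 (2 * s + 2) S →
         length S ≡ s / 2 + 1 →
         ∃₂ λ a a′ → a ∈ S × a′ ∈ S ×
           (a ≡ a′ + s ⊎ a ≡ a′ + (s + 1) ⊎ a ≡ a′ + (s + 2))
lemma2 s _ (divides q refl) S S⊆[n] stable |S|≡ with middleDifference? s S
... | inj₁ found = found
... | inj₂ free  =
  ⊥-elim (1+n≰n (subst (_≤ suc s) 2|S|≡ (MiddleDifferenceFreeStable.length-bound s S S⊆[n] stable free)))
  where
  double : ∀ q → (q + 1) + (q + 1) ≡ suc (suc (q * 2))
  double = solve-∀

  2|S|≡ : length S + length S ≡ suc (suc s)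
  2|S|≡ = trans (cong₂ _+_ |S|≡q+1 |S|≡q+1) (double q)
    where
    |S|≡q+1 : length S ≡ q + 1
    |S|≡q+1 = trans |S|≡ (cong (_+ 1) (m*n/n≡m q 2))
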